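{- Let $G$ be a graph which is not a complete graph and let $H$ be a graph with more than one vertex. Then the strong product $G\boxtimes H$ admits a barbell partition.
   Context: All graphs are finite and simple. $G\boxtimes H$ has vertex set $V(G)\times V(H)$, with $(g_1,h_1)(g_2,h_2)$ an edge iff either $g_1=g_2$ and $h_1h_2\in E(H)$, or $h_1=h_2$ and $g_1g_2\in E(G)$, or $g_1g_2\in E(G)$ and $h_1h_2\in E(H)$. A barbell partition of a graph $K$ is a partition of $V(K)$ into three disjoint sets $\{R,W_1,W_2\}$ with $W_1,W_2\neq\emptyset$ ($R$ may be empty), no edges between $W_1$ and $W_2$, and $|N_K(r)\cap W_i|\neq 1$ for all $r\in R$, $i\in\{1,2\}$. -}

module Defs where

open import Data.Nat using (ℕ; zero; suc; _+_)
open import Data.Fin using (Fin)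
open import Data.Bool using (Bool; true; false; _∧_; _∨_; if_then_else_)
open import Data.Product using (_×_; _,_; ∃; Σ-syntax; ∃-syntax)
open import Relation.Binary.PropositionalEquality using (_≡_; _≢_)
open import Relation.Nullary using (¬_)
open import Data.Fin.Properties using (_≟_)
open import Relation.Nullary.Decidable using (⌊_⌋)

record Graph : Set where
  field
    n      : ℕ
    adj    : Fin n → Fin n → Bool
    sym    : ∀ u v → adj u v ≡ adj v u
    irrefl : ∀ u → adj u u ≡ false
open Graph public

IsComplete : Graph → Set
IsComplete G = ∀ (u v : Fin (n G)) → u ≢ v → adj G u v ≡ true

sumFin : (k : ℕ) → (Fin k → ℕ) → ℕ
sumFin zero    f = 0
sumFin (suc k) f = f Fin.zero + sumFin k (λ i → f (Fin.suc i))

eqB : ∀ {k} → Fin k → Fin k → Bool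
eqB a b = ⌊ a ≟ b ⌋

strongAdj : (G H : Graph) → (Fin (n G) × Fin (n H)) → (Fin (n G) × Fin (n H)) → Bool
strongAdj G H (g₁ , h₁) (g₂ , h₂) =
  (eqB g₁ g₂ ∧ adj H h₁ h₂) ∨ (eqB h₁ h₂ ∧ adj G g₁ g₂) ∨ (adj G g₁ g₂ ∧ adj H h₁ h₂)

countProd : (G H : Graph) → (Fin (n G) × Fin (n H) → Bool) → ℕ
countProd G H P = sumFin (n G) (λ g → sumFin (n H) (λ h → if P (g , h) then 1 else 0))

data Part : Set where
  R W₁ W₂ : Part

isW : Part → Part → Bool
isW W₁ W₁ = true
isW W₂ W₂ = true
isW _  _  = false

IsBarbellPartitionProd : (G H : Graph) → (Fin (n G) × Fin (n H) → Part) → Set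
IsBarbellPartitionProd G H p =
    (∃[ x ] p x ≡ W₁)
  × (∃[ x ] p x ≡ W₂)
  × (∀ x y → p x ≡ W₁ → p y ≡ W₂ → strongAdj G H x y ≡ false)
  × (∀ r → p r ≡ R → ∀ (w : Part) → w ≢ R →
       countProd G H (λ v → strongAdj G H r v ∧ isW w (p v)) ≢ 1)

HasBarbellPartitionProd : Graph → Graph → Set
HasBarbellPartitionProd G H = ∃[ p ] IsBarbellPartitionProd G H p

-- Non-completeness of G gives distinct non-adjacent vertices u and v. If H has an
-- isolated vertex h₀, the layer G × {h₀} is a union of components of G ⊠ H, and
-- splitting it off (with R empty) is a barbell partition. Otherwise label each
-- vertex of G ⊠ H by the label of its G-coordinate under the partition
-- W₁ = {u}, R = N(u), W₂ = the rest of G. A vertex (g , h) in R that sees a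
-- vertex (g′ , h′) of some Wᵢ has g′ ≠ g, hence g ~ g′; then for any neighbour k
-- of h both (g′ , h) and (g′ , k) are neighbours of (g , h) in Wᵢ, so (g , h)
-- never sees exactly one vertex of Wᵢ.
module Submission where

open import Defs
open import Data.Bool using (Bool; true; false; _∧_; _∨_; if_then_else_)
open import Data.Bool.Properties using (∨-zeroʳ; ¬-not; not-¬) renaming (_≟_ to _≟ᵇ_)
open import Data.Fin using (Fin; fromℕ<)
open import Data.Fin.Properties using (_≟_; ¬∀⟶∃¬; any?; all?)
open import Data.Nat using (ℕ; zero; suc; _+_; _≤_; s≤s; z≤n)
open import Data.Nat.Properties using (0≢1+n; ≤-trans; m≤m+n; m≤n+m; +-monoʳ-≤; +-mono-≤; +-comm)
open import Data.Product using (_×_; _,_; ∃₂; ∃-syntax; proj₁; proj₂)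
open import Data.Sum using (_⊎_; inj₁; inj₂; [_,_])
open import Function using (_∘_; id; flip)
open import Relation.Binary.PropositionalEquality
  using (_≡_; _≢_; refl; trans; cong; subst) renaming (sym to ≡-sym)
open import Relation.Nullary using (¬_; Dec; yes; no; contradiction)
open import Relation.Nullary.Decidable using (_⊎-dec_)

eqB-refl : ∀ {k} (a : Fin k) → eqB a a ≡ true
eqB-refl a with a ≟ a
... | yes _   = refl
... | no a≢a = contradiction refl a≢a

eqB-≢ : ∀ {k} {a b : Fin k} → a ≢ b → eqB a b ≡ false
eqB-≢ {a = a} {b} a≢b with a ≟ b
... | yes a≡b = contradiction a≡b a≢b
... | no _    = refl

∧≡true-elim : ∀ {a b} → a ∧ b ≡ true → a ≡ true × b ≡ true
∧≡true-elim {true} {true} _ = refl , refl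

∧≡true-intro : ∀ {a b} → a ≡ true → b ≡ true → a ∧ b ≡ true
∧≡true-intro refl refl = refl

isW-R : ∀ w → isW w R ≡ false
isW-R R  = refl
isW-R W₁ = refl
isW-R W₂ = refl

sumFin-≥ : ∀ k (f : Fin k → ℕ) i → f i ≤ sumFin k f
sumFin-≥ (suc k) f Fin.zero    = m≤m+n _ _
sumFin-≥ (suc k) f (Fin.suc i) = ≤-trans (sumFin-≥ k (f ∘ Fin.suc) i) (m≤n+m _ _)

sumFin-≥-pair : ∀ k (f : Fin k → ℕ) {i j} → i ≢ j → f i + f j ≤ sumFin k f
sumFin-≥-pair (suc k) f {Fin.zero}  {Fin.zero}  0≢0 = contradiction refl 0≢0
sumFin-≥-pair (suc k) f {Fin.zero}  {Fin.suc j} _   = +-monoʳ-≤ (f Fin.zero) (sumFin-≥ k _ j)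
sumFin-≥-pair (suc k) f {Fin.suc i} {Fin.zero}  _
  rewrite +-comm (f (Fin.suc i)) (f Fin.zero) = +-monoʳ-≤ (f Fin.zero) (sumFin-≥ k _ i)
sumFin-≥-pair (suc k) f {Fin.suc i} {Fin.suc j} i≢j =
  ≤-trans (sumFin-≥-pair k (f ∘ Fin.suc) (i≢j ∘ cong Fin.suc)) (m≤n+m _ _)

sumFin-nonzero : ∀ k (f : Fin k → ℕ) → sumFin k f ≢ 0 → ∃[ i ] f i ≢ 0
sumFin-nonzero zero    f sum≢0 = contradiction refl sum≢0
sumFin-nonzero (suc k) f sum≢0 with f Fin.zero in f₀
... | suc _ = Fin.zero , λ f₀≡0 → 0≢1+n (trans (≡-sym f₀≡0) f₀)
... | zero with sumFin-nonzero k (f ∘ Fin.suc) sum≢0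
...   | i , fi≢0 = Fin.suc i , fi≢0

indicator : Bool → ℕ
indicator b = if b then 1 else 0

indicator-true : ∀ {b} → b ≡ true → 1 ≤ indicator b
indicator-true refl = s≤s z≤n

indicator-nonzero : ∀ b → indicator b ≢ 0 → b ≡ true
indicator-nonzero true  _    = refl
indicator-nonzero false 0≢0 = contradiction refl 0≢0

adj⇒≢ : (K : Graph) {a b : Fin (n K)} → adj K a b ≡ true → a ≢ b
adj⇒≢ K {a} a~a refl = not-¬ a~a (irrefl K a)

Isolated : (K : Graph) → Fin (n K) → Set
Isolated K a = ∀ b → adj K a b ≡ false

isolated? : (K : Graph) (a : Fin (n K)) → Dec (Isolated K a)
isolated? K a = all? λ b → adj K a b ≟ᵇ false

¬∀²⟶∃²¬ : ∀ m k (P : Fin m → Fin k → Set) → (∀ a b → Dec (P a b)) →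
          ¬ (∀ a b → P a b) → ∃₂ λ a b → ¬ P a b
¬∀²⟶∃²¬ m k P P? ¬∀∀ with ¬∀⟶∃¬ m (λ a → ∀ b → P a b) (λ a → all? (P? a)) ¬∀∀
... | a , ¬∀b with ¬∀⟶∃¬ k (P a) (P? a) ¬∀b
...   | b , ¬Pab = a , b , ¬Pab

nonadjacentPair : (K : Graph) → ¬ IsComplete K → ∃₂ λ u v → v ≢ u × adj K u v ≡ false
nonadjacentPair K incomplete
  with ¬∀²⟶∃²¬ (n K) (n K) (λ u v → u ≡ v ⊎ adj K u v ≡ true)
                 (λ u v → (u ≟ v) ⊎-dec (adj K u v ≟ᵇ true)) complete
  where
  complete : ¬ (∀ u v → u ≡ v ⊎ adj K u v ≡ true)
  complete equalOrAdjacent = incomplete λ u v u≢v → [ flip contradiction u≢v , id ] (equalOrAdjacent u v)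
... | u , v , ¬equalOrAdjacent = u , v , ¬equalOrAdjacent ∘ inj₁ ∘ ≡-sym , ¬-not (¬equalOrAdjacent ∘ inj₂)

¬isolated⇒neighbour : (K : Graph) {a : Fin (n K)} → ¬ Isolated K a → ∃[ b ] adj K a b ≡ true
¬isolated⇒neighbour K {a} ¬isolated
  with ¬∀⟶∃¬ (n K) (λ b → adj K a b ≡ false) (λ b → adj K a b ≟ᵇ false) ¬isolated
... | b , ¬a≁b = b , ¬-not ¬a≁b

another : ∀ {k} → 2 ≤ k → (a : Fin k) → ∃[ b ] b ≢ a
another (s≤s (s≤s _)) Fin.zero    = Fin.suc Fin.zero , λ ()
another (s≤s (s≤s _)) (Fin.suc _) = Fin.zero , λ ()

Separates : (K : Graph) → (Fin (n K) → Part) → Set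
Separates K q = ∀ a b → q a ≡ W₁ → q b ≡ W₂ → adj K a b ≡ false

separated⇒≢ : ∀ {k} (q : Fin k → Part) {a b} → q a ≡ W₁ → q b ≡ W₂ → a ≢ b
separated⇒≢ q qa qb refl with trans (≡-sym qa) qb
... | ()

pointLabel : ∀ {k} → Fin k → Fin k → Part
pointLabel a b with b ≟ a
... | yes _ = W₁
... | no _  = W₂

pointLabel-self : ∀ {k} (a : Fin k) → pointLabel a a ≡ W₁
pointLabel-self a with a ≟ a
... | yes _   = refl
... | no a≢a = contradiction refl a≢a

pointLabel-≢ : ∀ {k} {a b : Fin k} → b ≢ a → pointLabel a b ≡ W₂
pointLabel-≢ {a = a} {b} b≢a with b ≟ a
... | yes b≡a = contradiction b≡a b≢a
... | no _    = refl

pointLabel-≢R : ∀ {k} (a b : Fin k) → pointLabel a b ≢ R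
pointLabel-≢R a b with b ≟ a
... | yes _ = λ ()
... | no _  = λ ()

pointLabel-W₁ : ∀ {k} {a b : Fin k} → pointLabel a b ≡ W₁ → b ≡ a
pointLabel-W₁ {a = a} {b} _ with b ≟ a
pointLabel-W₁ _  | yes b≡a = b≡a
pointLabel-W₁ () | no _

pointLabel-separates : (K : Graph) {a : Fin (n K)} → Isolated K a → Separates K (pointLabel a)
pointLabel-separates K a-isolated b c qb _ rewrite pointLabel-W₁ qb = a-isolated c

neighbourhoodLabel : (K : Graph) → Fin (n K) → Fin (n K) → Part
neighbourhoodLabel K u g with g ≟ u | adj K u g
... | yes _ | _     = W₁
... | no _  | true  = R
... | no _  | false = W₂

module _ (K : Graph) {u : Fin (n K)} where

  neighbourhoodLabel-self : neighbourhoodLabel K u u ≡ W₁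
  neighbourhoodLabel-self with u ≟ u
  ... | yes _   = refl
  ... | no u≢u = contradiction refl u≢u

  neighbourhoodLabel-nonadjacent : ∀ {v} → v ≢ u → adj K u v ≡ false → neighbourhoodLabel K u v ≡ W₂
  neighbourhoodLabel-nonadjacent {v} v≢u u≁v with v ≟ u | adj K u v
  ... | yes v≡u | _     = contradiction v≡u v≢u
  ... | no _    | false = refl
  ... | no _    | true  with () ← u≁v

  neighbourhoodLabel-W₁ : ∀ {a} → neighbourhoodLabel K u a ≡ W₁ → a ≡ u
  neighbourhoodLabel-W₁ {a} _ with a ≟ u | adj K u a
  neighbourhoodLabel-W₁ _  | yes a≡u | _     = a≡u
  neighbourhoodLabel-W₁ () | no _    | true
  neighbourhoodLabel-W₁ () | no _    | false

  neighbourhoodLabel-W₂ : ∀ {b} → neighbourhoodLabel K u b ≡ W₂ → adj K u b ≡ false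
  neighbourhoodLabel-W₂ {b} _ with b ≟ u | adj K u b
  neighbourhoodLabel-W₂ () | yes _ | _
  neighbourhoodLabel-W₂ () | no _  | true
  neighbourhoodLabel-W₂ _  | no _  | false = refl

  neighbourhoodLabel-separates : Separates K (neighbourhoodLabel K u)
  neighbourhoodLabel-separates a b qa qb
    rewrite neighbourhoodLabel-W₁ qa = neighbourhoodLabel-W₂ qb

module _ (G H : Graph) where

  countProd-witness : ∀ P → countProd G H P ≢ 0 → ∃[ x ] P x ≡ true
  countProd-witness P count≢0 with sumFin-nonzero (n G) _ count≢0
  ... | g , row≢0 with sumFin-nonzero (n H) _ row≢0
  ...   | h , entry≢0 = (g , h) , indicator-nonzero _ entry≢0

  countProd-≥2 : ∀ P {x y : Fin (n G) × Fin (n H)} → x ≢ y → P x ≡ true → P y ≡ true → 2 ≤ countProd G H P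
  countProd-≥2 P {g , h} {g′ , h′} x≢y Px Py with g ≟ g′
  ... | no g≢g′ = ≤-trans (+-mono-≤ (entry≤ Px) (entry≤ Py)) (sumFin-≥-pair (n G) _ g≢g′)
    where
    entry≤ : ∀ {a b} → P (a , b) ≡ true → 1 ≤ sumFin (n H) (indicator ∘ P ∘ (a ,_))
    entry≤ {b = b} Pab = ≤-trans (indicator-true Pab) (sumFin-≥ (n H) _ b)
  ... | yes refl =
    ≤-trans (≤-trans (+-mono-≤ (indicator-true Px) (indicator-true Py))
                     (sumFin-≥-pair (n H) (indicator ∘ P ∘ (g ,_)) (x≢y ∘ cong (g ,_))))
            (sumFin-≥ (n G) _ g)

  countProd-≢1 : ∀ P → (∀ x → P x ≡ true → ∃₂ λ y z → y ≢ z × P y ≡ true × P z ≡ true) →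
                 countProd G H P ≢ 1
  countProd-≢1 P pairUp count≡1
    with pairUp _ (proj₂ (countProd-witness P (λ count≡0 → 0≢1+n (trans (≡-sym count≡0) count≡1))))
  ... | y , z , y≢z , Py , Pz with subst (2 ≤_) count≡1 (countProd-≥2 P y≢z Py Pz)
  ...   | s≤s ()

  strongAdj-horizontal : ∀ {g g′} h → adj G g g′ ≡ true → strongAdj G H (g , h) (g′ , h) ≡ true
  strongAdj-horizontal h g~g′ rewrite eqB-refl h | g~g′ = ∨-zeroʳ _

  strongAdj-diagonal : ∀ {g g′ h h′} → adj G g g′ ≡ true → adj H h h′ ≡ true →
                       strongAdj G H (g , h) (g′ , h′) ≡ true
  strongAdj-diagonal {g} {g′} {h} {h′} g~g′ h~h′
    rewrite g~g′ | h~h′ | ∨-zeroʳ (eqB h h′ ∧ true) = ∨-zeroʳ _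

  strongAdj⇒adjˡ : ∀ {g g′ h h′} → g ≢ g′ → strongAdj G H (g , h) (g′ , h′) ≡ true → adj G g g′ ≡ true
  strongAdj⇒adjˡ {g} {g′} {h} {h′} g≢g′ edge with eqB g g′ | eqB-≢ g≢g′
  ... | .false | refl = witness (eqB h h′) (adj G g g′) edge
    where
    witness : ∀ b a {c} → (b ∧ a) ∨ (a ∧ c) ≡ true → a ≡ true
    witness _     true  _  = refl
    witness true  false ()
    witness false false ()

  strongAdj⇒adjʳ : ∀ {g g′ h h′} → h ≢ h′ → strongAdj G H (g , h) (g′ , h′) ≡ true → adj H h h′ ≡ true
  strongAdj⇒adjʳ {g} {g′} {h} {h′} h≢h′ edge with eqB h h′ | eqB-≢ h≢h′
  ... | .false | refl = witness (eqB g g′) (adj G g g′) (adj H h h′) edge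
    where
    witness : ∀ e a b → (e ∧ b) ∨ (a ∧ b) ≡ true → b ≡ true
    witness _     _     true  _  = refl
    witness true  true  false ()
    witness true  false false ()
    witness false true  false ()
    witness false false false ()

  liftˡ-isBarbell : (q : Fin (n G) → Part) → Fin (n H) → (∀ h → ∃[ k ] adj H h k ≡ true) →
                    ∃[ a ] q a ≡ W₁ → ∃[ b ] q b ≡ W₂ → Separates G q →
                    IsBarbellPartitionProd G H (q ∘ proj₁)
  liftˡ-isBarbell q h₀ neighbour (a , qa) (b , qb) separates =
    ((a , h₀) , qa) , ((b , h₀) , qb) , noCrossEdge , balanced
    where
    noCrossEdge : ∀ x y → q (proj₁ x) ≡ W₁ → q (proj₁ y) ≡ W₂ → strongAdj G H x y ≡ false
    noCrossEdge (g , _) (g′ , _) qg qg′ = ¬-not λ edge →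
      not-¬ (strongAdj⇒adjˡ (separated⇒≢ q qg qg′) edge) (separates g g′ qg qg′)

    balanced : ∀ r → q (proj₁ r) ≡ R → ∀ w → w ≢ R →
               countProd G H (λ v → strongAdj G H r v ∧ isW w (q (proj₁ v))) ≢ 1
    balanced (g , h) qg w _ with neighbour h
    ... | k , h~k = countProd-≢1 _ pairUp
      where
      pairUp : ∀ x → strongAdj G H (g , h) x ∧ isW w (q (proj₁ x)) ≡ true →
               ∃₂ λ y z → y ≢ z × strongAdj G H (g , h) y ∧ isW w (q (proj₁ y)) ≡ true
                                × strongAdj G H (g , h) z ∧ isW w (q (proj₁ z)) ≡ true
      pairUp (g′ , h′) seen with ∧≡true-elim seen
      ... | edge , inW = (g′ , h) , (g′ , k) , adj⇒≢ H h~k ∘ cong proj₂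
                       , ∧≡true-intro (strongAdj-horizontal h g~g′) inW
                       , ∧≡true-intro (strongAdj-diagonal g~g′ h~k) inW
        where
        g≢g′ : g ≢ g′
        g≢g′ refl = not-¬ inW (trans (cong (isW w) qg) (isW-R w))
        g~g′ : adj G g g′ ≡ true
        g~g′ = strongAdj⇒adjˡ g≢g′ edge

  liftʳ-isBarbell : (q : Fin (n H) → Part) → Fin (n G) → (∀ h → q h ≢ R) →
                    ∃[ a ] q a ≡ W₁ → ∃[ b ] q b ≡ W₂ → Separates H q →
                    IsBarbellPartitionProd G H (q ∘ proj₂)
  liftʳ-isBarbell q g₀ noR (a , qa) (b , qb) separates =
    ((g₀ , a) , qa) , ((g₀ , b) , qb) , noCrossEdge , λ r qr → contradiction qr (noR (proj₂ r))
    where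
    noCrossEdge : ∀ x y → q (proj₂ x) ≡ W₁ → q (proj₂ y) ≡ W₂ → strongAdj G H x y ≡ false
    noCrossEdge (g , h) (g′ , h′) qh qh′ = ¬-not λ edge →
      not-¬ (strongAdj⇒adjʳ {g} {g′} (separated⇒≢ q qh qh′) edge) (separates h h′ qh qh′)

mainTheorem20 : (G H : Graph) → ¬ IsComplete G → 2 ≤ n H → HasBarbellPartitionProd G H
mainTheorem20 G H incomplete 2≤|H| with nonadjacentPair G incomplete | any? (isolated? H)
... | u , v , v≢u , u≁v | no noIsolated =
  _ , liftˡ-isBarbell G H (neighbourhoodLabel G u) (fromℕ< 2≤|H|)
        (λ h → ¬isolated⇒neighbour H (λ h-isolated → noIsolated (h , h-isolated)))
        (u , neighbourhoodLabel-self G) (v , neighbourhoodLabel-nonadjacent G v≢u u≁v)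
        (neighbourhoodLabel-separates G)
... | u , _ , _ , _ | yes (h₀ , h₀-isolated) with another 2≤|H| h₀
...   | h₁ , h₁≢h₀ =
  _ , liftʳ-isBarbell G H (pointLabel h₀) u (pointLabel-≢R h₀)
        (h₀ , pointLabel-self h₀) (h₁ , pointLabel-≢ h₁≢h₀) (pointLabel-separates H h₀-isolated)
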